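{- For any pair of nontrivial finite simple connected graphs $G$ and $H$: (i) $\gamma_P(G\circ H)=1$ if and only if $\gamma(G)=1$ and $\gamma_P(H)=1$; (ii) $\gamma_P(G\circ H)=2$ if and only if either $\gamma(G)=2$ and $\gamma_P(H)=1$, or $\operatorname{diam}(\overline{G})>2$ and $\gamma_P(H)>1$.
   Context: The lexicographic product $G\circ H$ has vertex set $V(G)\times V(H)$, with $(g,h)$ adjacent to $(g',h')$ iff $gg'\in E(G)$, or $g=g'$ and $hh'\in E(H)$. $\overline{G}$ is the complement of $G$, $\gamma(G)$ the domination number. Zero forcing: for $U\subseteq V(G)$ (black vertices), repeatedly apply the rule "if a black vertex has exactly one white neighbor, that neighbor becomes black"; the resulting set is the closure $cl(U)$. A set $S$ is a power dominating set if $cl(N[S])=V(G)$, where $N[S]$ is the closed neighborhood of $S$; $\gamma_P(G)$ is the minimum cardinality of a power dominating set. -}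

module Defs where

open import Data.Nat using (ℕ; zero; suc; _*_; _≤_; _<_)
open import Data.Fin using (Fin; quotient; remainder)
open import Data.Fin.Subset using (Subset; _∈_; ∣_∣)
open import Data.Bool using (Bool; true; false; _∧_; _∨_; not)
open import Data.Product using (Σ; ∃; _×_; _,_)
open import Data.Sum using (_⊎_)
open import Relation.Nullary using (¬_)
open import Relation.Binary.PropositionalEquality using (_≡_; _≢_)

record Graph (n : ℕ) : Set where
  field
    adj    : Fin n → Fin n → Bool
    adj-sym    : ∀ u v → adj u v ≡ adj v u
    adj-irrefl : ∀ v → adj v v ≡ false
open Graph public

Adj : ∀ {n} → Graph n → Fin n → Fin n → Set
Adj G u v = adj G u v ≡ true

Nontrivial : ∀ {n} → Graph n → Set
Nontrivial {n} _ = 2 ≤ n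

data Reach {n} (G : Graph n) (u : Fin n) : Fin n → Set where
  here : Reach G u u
  step : ∀ {v w} → Reach G u v → Adj G v w → Reach G u w

Connected : ∀ {n} → Graph n → Set
Connected {n} G = ∀ (u v : Fin n) → Reach G u v

complement : ∀ {n} → Graph n → Graph n
complement {n} G = record
  { adj = λ u v → not (adj G u v) ∧ not (eqb u v)
  ; adj-sym = λ u v → symPf u v
  ; adj-irrefl = λ v → irr v }
  where
    open import Data.Fin.Properties using (_≟_)
    open import Relation.Nullary.Decidable using (⌊_⌋)
    open import Relation.Nullary using (yes; no)
    open import Relation.Binary.PropositionalEquality using (refl; sym; cong₂; cong)
    eqb : Fin n → Fin n → Bool
    eqb u v = ⌊ u ≟ v ⌋
    eqbSym : ∀ u v → eqb u v ≡ eqb v u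
    eqbSym u v with u ≟ v | v ≟ u
    ... | yes _ | yes _ = refl
    ... | no _  | no _  = refl
    ... | yes p | no q = Data.Empty.⊥-elim (q (sym p)) where import Data.Empty
    ... | no p  | yes q = Data.Empty.⊥-elim (p (sym q)) where import Data.Empty
    symPf : ∀ u v → (not (adj G u v) ∧ not (eqb u v)) ≡ (not (adj G v u) ∧ not (eqb v u))
    symPf u v = cong₂ (λ a b → not a ∧ not b) (Graph.adj-sym G u v) (eqbSym u v)
    irr : ∀ v → (not (adj G v v) ∧ not (eqb v v)) ≡ false
    irr v with v ≟ v
    ... | yes _ = Data.Bool.Properties.∧-zeroʳ (not (adj G v v)) where import Data.Bool.Properties
    ... | no ¬p = Data.Empty.⊥-elim (¬p refl) where import Data.Empty

DistLe2 : ∀ {n} → Graph n → Fin n → Fin n → Set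
DistLe2 G u v = u ≡ v ⊎ Adj G u v ⊎ ∃ λ w → Adj G u w × Adj G w v

-- diam(G) > 2 (diameter of a disconnected graph is ∞)
DiamGt2 : ∀ {n} → Graph n → Set
DiamGt2 {n} G = Σ (Fin n) λ u → Σ (Fin n) λ v → ¬ DistLe2 G u v

-- lexicographic product G ∘ H on Fin (m * n); vertex i corresponds to
-- (quotient n i , remainder n i), a bijection Fin (m * n) ≅ Fin m × Fin n
lexProd : ∀ {m n} → Graph m → Graph n → Graph (m * n)
lexProd {m} {n} G H = record
  { adj = λ i j → adj G (quotient n i) (quotient n j)
                  ∨ (⌊ quotient n i ≟ quotient n j ⌋ ∧ adj H (remainder {m} n i) (remainder {m} n j))
  ; adj-sym = λ i j → cong₂ _∨_ (Graph.adj-sym G (quotient n i) (quotient n j))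
                    (cong₂ _∧_ (eqbSym (quotient n i) (quotient n j))
                               (Graph.adj-sym H (remainder {m} n i) (remainder {m} n j)))
  ; adj-irrefl = λ i → irr i }
  where
    open import Data.Fin.Properties using (_≟_)
    open import Relation.Nullary.Decidable using (⌊_⌋)
    open import Relation.Nullary using (yes; no)
    open import Relation.Binary.PropositionalEquality using (refl; sym; cong₂; cong)
    import Data.Empty
    eqbSym : ∀ (u v : Fin m) → ⌊ u ≟ v ⌋ ≡ ⌊ v ≟ u ⌋
    eqbSym u v with u ≟ v | v ≟ u
    ... | yes _ | yes _ = refl
    ... | no _  | no _  = refl
    ... | yes p | no q = Data.Empty.⊥-elim (q (sym p))
    ... | no p  | yes q = Data.Empty.⊥-elim (p (sym q))
    irr : ∀ i → (adj G (quotient n i) (quotient n i)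
                  ∨ (⌊ quotient n i ≟ quotient n i ⌋ ∧ adj H (remainder {m} n i) (remainder {m} n i))) ≡ false
    irr i rewrite Graph.adj-irrefl G (quotient n i) | Graph.adj-irrefl H (remainder {m} n i) =
      Data.Bool.Properties.∧-zeroʳ ⌊ quotient n i ≟ quotient n i ⌋
      where import Data.Bool.Properties

Dominating : ∀ {n} → Graph n → Subset n → Set
Dominating {n} G S = ∀ v → v ∈ S ⊎ ∃ λ s → s ∈ S × Adj G s v

IsDomNum : ∀ {n} → Graph n → ℕ → Set
IsDomNum {n} G k = (Σ (Subset n) λ S → Dominating G S × ∣ S ∣ ≡ k)
                 × (∀ (S : Subset n) → Dominating G S → k ≤ ∣ S ∣)

InClosedNbhd : ∀ {n} → Graph n → Subset n → Fin n → Set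
InClosedNbhd G S v = v ∈ S ⊎ ∃ λ s → s ∈ S × Adj G s v

-- zero forcing closure cl(U) of a set U (given as a predicate): the least set
-- containing U and closed under the colour-change rule
-- "a black vertex u with exactly one white neighbour v forces v".
data InClosure {n} (G : Graph n) (U : Fin n → Set) : Fin n → Set where
  init  : ∀ {v} → U v → InClosure G U v
  force : ∀ {u v} → InClosure G U u → Adj G u v
        → (∀ w → Adj G u w → w ≢ v → InClosure G U w)
        → InClosure G U v

PowerDominating : ∀ {n} → Graph n → Subset n → Set
PowerDominating {n} G S = ∀ v → InClosure G (InClosedNbhd G S) v

IsPowDomNum : ∀ {n} → Graph n → ℕ → Set
IsPowDomNum {n} G k = (Σ (Subset n) λ S → PowerDominating G S × ∣ S ∣ ≡ k)
                    × (∀ (S : Subset n) → PowerDominating G S → k ≤ ∣ S ∣)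

PowDomNumGt : ∀ {n} → Graph n → ℕ → Set
PowDomNumGt {n} G k = ∀ (S : Subset n) → PowerDominating G S → k < ∣ S ∣

module Submission where

-- Forcing inside one H-layer of G ∘ H can be replayed in H. Hence, if S power dominates G ∘ H,
-- every layer meets N[S], so the first coordinates of S dominate G; and if the only vertex of S in
-- or next to the layer of s is s itself, then snd s power dominates H. Conversely D × {h}
-- power dominates G ∘ H whenever D dominates G and {h} power dominates H. This settles
-- γ_P(G ∘ H) = 1. For a minimum S = {x, y}: if x, y share a layer, or lie in adjacent layers
-- while γ_P(H) > 1, then G has vertices u, v such that every vertex is adjacent to u or v,
-- which is exactly diam(Ḡ) > 2; otherwise γ(G) = 2 and γ_P(H) = 1. Telling the last two cases
-- apart needs γ_P(H) = 1 to be decidable, which holds as the zero forcing closure is computable.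

open import Defs
open import Data.Nat using (ℕ; zero; suc; _≤_; _<_; z≤n; s≤s; _+_; _*_)
import Data.Nat.Properties as ℕ
open import Data.Fin using (Fin; zero; suc; fromℕ<; quotient; remainder; combine)
open import Data.Fin.Properties using (_≟_; any?; all?; ¬∀⟶∃¬; remQuot-combine; combine-remQuot)
open import Data.Fin.Subset using (Subset; _∈_; _∉_; _⊆_; ∣_∣; ⁅_⁆; _∪_; _-_; Nonempty)
import Data.Fin.Subset as Subset
open import Data.Fin.Subset.Properties
  using (_∈?_; nonempty?; ∉⊥; ∣p∣≤n; x∈⁅x⁆; x∈⁅y⁆⇒x≡y; ∣⁅x⁆∣≡1; x∈p∪q⁺; x∈p∪q⁻;
         ∪-identityˡ; ∪-identityʳ; ∪-idem; ⊆-reflexive; p⊆p∪q; x∈p∧x≢y⇒x∈p-y; x∈p⇒∣p-x∣<∣p∣; p⊂q⇒∣p∣<∣q∣)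
open import Data.Vec.Base using (_∷_; there)
open import Data.Bool using (true; false)
import Data.Bool.Properties as Bool
open import Data.Product using (Σ; ∃; ∃₂; _×_; _,_; proj₁; proj₂)
open import Data.Sum using (_⊎_; inj₁; inj₂; [_,_]′)
import Data.Sum
open import Data.Empty using (⊥; ⊥-elim)
open import Relation.Nullary using (¬_; Dec; yes; no; ¬?; contradiction)
open import Relation.Nullary.Decidable using (_×-dec_; _⊎-dec_; _→-dec_)
open import Relation.Binary.PropositionalEquality using (_≡_; _≢_; refl; sym; trans; cong; subst)
open import Function.Bundles using (_⇔_; mk⇔; Equivalence)
import Function.Properties.Equivalence as ⇔
open import Data.Product.Function.NonDependent.Propositional using (_×-⇔_)
open import Data.Sum.Function.Propositional using (_⊎-⇔_)

x∈⁅x⁆∪⁅y⁆ : ∀ {k} {x y : Fin k} → x ∈ ⁅ x ⁆ ∪ ⁅ y ⁆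
x∈⁅x⁆∪⁅y⁆ {x = x} = x∈p∪q⁺ (inj₁ (x∈⁅x⁆ x))

y∈⁅x⁆∪⁅y⁆ : ∀ {k} {x y : Fin k} → y ∈ ⁅ x ⁆ ∪ ⁅ y ⁆
y∈⁅x⁆∪⁅y⁆ {y = y} = x∈p∪q⁺ (inj₂ (x∈⁅x⁆ y))

x∈⁅x⁆∪⁅y⁆⁻ : ∀ {k} {x y z : Fin k} → z ∈ ⁅ x ⁆ ∪ ⁅ y ⁆ → z ≡ x ⊎ z ≡ y
x∈⁅x⁆∪⁅y⁆⁻ {x = x} {y} z∈ = Data.Sum.map (x∈⁅y⁆⇒x≡y x) (x∈⁅y⁆⇒x≡y y) (x∈p∪q⁻ ⁅ x ⁆ ⁅ y ⁆ z∈)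

⁅x⁆∪⁅y⁆⊆⁅x⁆ : ∀ {k} {x y : Fin k} → x ≡ y → ⁅ x ⁆ ∪ ⁅ y ⁆ ⊆ ⁅ x ⁆
⁅x⁆∪⁅y⁆⊆⁅x⁆ refl = ⊆-reflexive (∪-idem _)

x∈⁅y⁆⇒fx∈⁅fy⁆ : ∀ {k l} (f : Fin k → Fin l) {x y} → x ∈ ⁅ y ⁆ → f x ∈ ⁅ f y ⁆
x∈⁅y⁆⇒fx∈⁅fy⁆ f {y = y} x∈⁅y⁆ rewrite x∈⁅y⁆⇒x≡y y x∈⁅y⁆ = x∈⁅x⁆ (f y)

x∈⁅y⁆∪⁅z⁆⇒fx∈⁅fy⁆∪⁅fz⁆ : ∀ {k l} (f : Fin k → Fin l) {x y z} → x ∈ ⁅ y ⁆ ∪ ⁅ z ⁆ → f x ∈ ⁅ f y ⁆ ∪ ⁅ f z ⁆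
x∈⁅y⁆∪⁅z⁆⇒fx∈⁅fy⁆∪⁅fz⁆ f x∈ with x∈⁅x⁆∪⁅y⁆⁻ x∈
... | inj₁ refl = x∈⁅x⁆∪⁅y⁆
... | inj₂ refl = y∈⁅x⁆∪⁅y⁆

x∉p-x : ∀ {k} {p : Subset k} {x} → x ∉ p - x
x∉p-x {p = _ ∷ _} {zero} ()
x∉p-x {p = _ ∷ _} {suc x} (there x∈p-x) = x∉p-x x∈p-x

∣⁅x⁆∪⁅y⁆∣≡2 : ∀ {k} {x y : Fin k} → x ≢ y → ∣ ⁅ x ⁆ ∪ ⁅ y ⁆ ∣ ≡ 2
∣⁅x⁆∪⁅y⁆∣≡2 {x = zero} {zero} 0≢0 = contradiction refl 0≢0
∣⁅x⁆∪⁅y⁆∣≡2 {x = zero} {suc y} _ = cong suc (trans (cong ∣_∣ (∪-identityˡ ⁅ y ⁆)) (∣⁅x⁆∣≡1 y))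
∣⁅x⁆∪⁅y⁆∣≡2 {x = suc x} {zero} _ = cong suc (trans (cong ∣_∣ (∪-identityʳ ⁅ x ⁆)) (∣⁅x⁆∣≡1 x))
∣⁅x⁆∪⁅y⁆∣≡2 {x = suc x} {suc y} x≢y = ∣⁅x⁆∪⁅y⁆∣≡2 (λ x≡y → x≢y (cong suc x≡y))

module _ {k : ℕ} where

  x∈p⇒0<∣p∣ : ∀ {p : Subset k} {x} → x ∈ p → 0 < ∣ p ∣
  x∈p⇒0<∣p∣ x∈p = ℕ.≤-<-trans z≤n (x∈p⇒∣p-x∣<∣p∣ x∈p)

  ∣p∣≤1⇒p⊆⁅x⁆ : ∀ {p : Subset k} {x} → x ∈ p → ∣ p ∣ ≤ 1 → p ⊆ ⁅ x ⁆
  ∣p∣≤1⇒p⊆⁅x⁆ {p} {x} x∈p ∣p∣≤1 {y} y∈p with y ≟ x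
  ... | yes refl = x∈⁅x⁆ x
  ... | no y≢x = contradiction 1<1 (ℕ.<-irrefl refl)
    where
    1<1 : 1 < 1
    1<1 = ℕ.<-≤-trans (ℕ.≤-<-trans (x∈p⇒0<∣p∣ (x∈p∧x≢y⇒x∈p-y y∈p y≢x)) (x∈p⇒∣p-x∣<∣p∣ x∈p)) ∣p∣≤1

  x∈p⇒x≡y⊎x∈p-y : ∀ {p : Subset k} {x} y → x ∈ p → x ≡ y ⊎ x ∈ p - y
  x∈p⇒x≡y⊎x∈p-y {x = x} y x∈p with x ≟ y
  ... | yes x≡y = inj₁ x≡y
  ... | no x≢y = inj₂ (x∈p∧x≢y⇒x∈p-y x∈p x≢y)

  ∣p∣≤2⇒p⊆⁅x⁆∪⁅y⁆ : ∀ {p : Subset k} {x} → x ∈ p → ∣ p ∣ ≤ 2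
                  → p ⊆ ⁅ x ⁆ ⊎ ∃ λ y → x ≢ y × p ⊆ ⁅ x ⁆ ∪ ⁅ y ⁆
  ∣p∣≤2⇒p⊆⁅x⁆∪⁅y⁆ {p} {x} x∈p ∣p∣≤2 with nonempty? (p - x)
  ... | no p-x≡∅ = inj₁ λ z∈p →
    [ (λ { refl → x∈⁅x⁆ x }) , (λ z∈p-x → contradiction (_ , z∈p-x) p-x≡∅) ]′ (x∈p⇒x≡y⊎x∈p-y x z∈p)
  ... | yes (y , y∈p-x) = inj₂ (y , x≢y , λ z∈p →
    x∈p∪q⁺ (Data.Sum.map (λ { refl → x∈⁅x⁆ x }) p-x⊆⁅y⁆ (x∈p⇒x≡y⊎x∈p-y x z∈p)))
    where
    x≢y : x ≢ y
    x≢y refl = x∉p-x y∈p-x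
    p-x⊆⁅y⁆ : p - x ⊆ ⁅ y ⁆
    p-x⊆⁅y⁆ = ∣p∣≤1⇒p⊆⁅x⁆ y∈p-x (ℕ.≤-pred (ℕ.<-≤-trans (x∈p⇒∣p-x∣<∣p∣ x∈p) ∣p∣≤2))

NoIsolated : ∀ {k} → Graph k → Set
NoIsolated {k} K = ∀ (v : Fin k) → ∃ λ u → Adj K u v

TotallyDominating : ∀ {k} → Graph k → Subset k → Set
TotallyDominating K D = ∀ v → ∃ λ d → d ∈ D × Adj K d v

another : ∀ {k} → 2 ≤ k → (x : Fin k) → ∃ λ y → y ≢ x
another (s≤s (s≤s _)) zero = suc zero , λ ()
another (s≤s (s≤s _)) (suc x) = zero , λ ()

connected⇒noIsolated : ∀ {k} {K : Graph k} → Nontrivial K → Connected K → NoIsolated K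
connected⇒noIsolated {K = K} nontrivial connected v with another nontrivial v
... | u , u≢v = lastStep (connected u v) u≢v
  where
  lastStep : ∀ {u} → Reach K u v → u ≢ v → ∃ λ w → Adj K w v
  lastStep here v≢v = contradiction refl v≢v
  lastStep (step _ w~v) _ = _ , w~v

module _ {k : ℕ} {K : Graph k} where

  Adj? : ∀ u v → Dec (Adj K u v)
  Adj? u v = adj K u v Bool.≟ true

  Adj⇒≢ : ∀ {u v} → Adj K u v → u ≢ v
  Adj⇒≢ {u} u~u refl with trans (sym u~u) (adj-irrefl K u)
  ... | ()

  Adj-sym : ∀ {u v} → Adj K u v → Adj K v u
  Adj-sym {u} {v} u~v = trans (adj-sym K v u) u~v

  closure-mono : ∀ {U V : Fin k → Set} → (∀ {v} → U v → V v) → ∀ {v} → InClosure K U v → InClosure K V v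
  closure-mono U⊆V (init u) = init (U⊆V u)
  closure-mono U⊆V (force u∈ u~v rest) =
    force (closure-mono U⊆V u∈) u~v (λ w u~w w≢v → closure-mono U⊆V (rest w u~w w≢v))

  closure⇒seed : ∀ {U : Fin k → Set} {v} → InClosure K U v → ∃ U
  closure⇒seed (init u) = _ , u
  closure⇒seed (force u∈ _ _) = closure⇒seed u∈

  closedNbhd-mono : ∀ {S T : Subset k} → S ⊆ T → ∀ {v} → InClosedNbhd K S v → InClosedNbhd K T v
  closedNbhd-mono S⊆T (inj₁ v∈S) = inj₁ (S⊆T v∈S)
  closedNbhd-mono S⊆T (inj₂ (s , s∈S , s~v)) = inj₂ (s , S⊆T s∈S , s~v)

  closedNbhd⇒Nonempty : ∀ {S : Subset k} {v} → InClosedNbhd K S v → Nonempty S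
  closedNbhd⇒Nonempty (inj₁ v∈S) = _ , v∈S
  closedNbhd⇒Nonempty (inj₂ (s , s∈S , _)) = s , s∈S

  powerDominating-mono : ∀ {S T : Subset k} → S ⊆ T → PowerDominating K S → PowerDominating K T
  powerDominating-mono S⊆T pd v = closure-mono (closedNbhd-mono S⊆T) (pd v)

  dominating-mono : ∀ {S T : Subset k} → S ⊆ T → Dominating K S → Dominating K T
  dominating-mono S⊆T dom v = closedNbhd-mono S⊆T (dom v)

  dominating⇒powerDominating : ∀ {S : Subset k} → Dominating K S → PowerDominating K S
  dominating⇒powerDominating dom v = init (dom v)

  powerDominating⇒Nonempty : ∀ {S : Subset k} → Fin k → PowerDominating K S → Nonempty S
  powerDominating⇒Nonempty v pd = closedNbhd⇒Nonempty (proj₂ (closure⇒seed (pd v)))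

  dominating⇒Nonempty : ∀ {S : Subset k} → Fin k → Dominating K S → Nonempty S
  dominating⇒Nonempty v dom = closedNbhd⇒Nonempty (dom v)

  dominating-⁅u⁆⇒adj : ∀ {u v} → Dominating K ⁅ u ⁆ → v ≢ u → Adj K u v
  dominating-⁅u⁆⇒adj {u} {v} dom v≢u with dom v
  ... | inj₁ v∈⁅u⁆ = contradiction (x∈⁅y⁆⇒x≡y u v∈⁅u⁆) v≢u
  ... | inj₂ (d , d∈⁅u⁆ , d~v) rewrite x∈⁅y⁆⇒x≡y u d∈⁅u⁆ = d~v

  -- Decide by saturation: repeatedly add a seed vertex or a forced vertex to a set B ⊆ cl(U)
  -- until nothing changes; the result is then cl(U) itself.
  module _ {U : Fin k → Set} (U? : ∀ v → Dec (U v)) where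
    private
      Forceable : Subset k → Fin k → Set
      Forceable B v = v ∉ B × (U v ⊎ ∃ λ u → u ∈ B × Adj K u v × (∀ w → Adj K u w → w ≢ v → w ∈ B))

      forceable? : ∀ B v → Dec (Forceable B v)
      forceable? B v = ¬? (v ∈? B) ×-dec (U? v ⊎-dec any? λ u →
        (u ∈? B) ×-dec Adj? u v ×-dec all? λ w → Adj? u w →-dec ¬? (w ≟ v) →-dec (w ∈? B))

      closure⊆ : ∀ {B} → ¬ ∃ (Forceable B) → ∀ {v} → InClosure K U v → v ∈ B
      closure⊆ {B} stuck {v} v∈ with v ∈? B
      ... | yes v∈B = v∈B
      closure⊆ stuck (init u) | no v∉B = contradiction (_ , v∉B , inj₁ u) stuck
      closure⊆ stuck (force {u} u∈ u~v rest) | no v∉B =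
        contradiction (_ , v∉B , inj₂ (u , closure⊆ stuck u∈ , u~v , λ w u~w w≢v → closure⊆ stuck (rest w u~w w≢v)))
                      stuck

      add-forceable : ∀ {B v} → (∀ {w} → w ∈ B → InClosure K U w) → Forceable B v
                    → ∀ {w} → w ∈ B ∪ ⁅ v ⁆ → InClosure K U w
      add-forceable {B} {v} B⊆cl (_ , v-forced) w∈ with x∈p∪q⁻ B ⁅ v ⁆ w∈
      ... | inj₁ w∈B = B⊆cl w∈B
      ... | inj₂ w∈⁅v⁆ with x∈⁅y⁆⇒x≡y v w∈⁅v⁆ | v-forced
      ...   | refl | inj₁ u = init u
      ...   | refl | inj₂ (u , u∈B , u~v , rest) = force (B⊆cl u∈B) u~v (λ w u~w w≢v → B⊆cl (rest w u~w w≢v))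

      saturate : ∀ fuel (B : Subset k) → k ≤ fuel + ∣ B ∣ → (∀ {w} → w ∈ B → InClosure K U w)
               → Dec (∀ v → InClosure K U v)
      saturate fuel B k≤ B⊆cl with any? (forceable? B)
      ... | yes (v , v-forceable@(v∉B , _)) = continue fuel k≤
        where
        grows : ∣ B ∣ < ∣ B ∪ ⁅ v ⁆ ∣
        grows = p⊂q⇒∣p∣<∣q∣ ((λ w∈B → x∈p∪q⁺ (inj₁ w∈B)) , v , x∈p∪q⁺ (inj₂ (x∈⁅x⁆ v)) , v∉B)
        continue : ∀ fuel → k ≤ fuel + ∣ B ∣ → Dec (∀ v → InClosure K U v)
        continue zero k≤∣B∣ =
          contradiction (ℕ.<-≤-trans (ℕ.≤-<-trans k≤∣B∣ grows) (∣p∣≤n (B ∪ ⁅ v ⁆))) (ℕ.<-irrefl refl)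
        continue (suc fuel) k≤ = saturate fuel (B ∪ ⁅ v ⁆)
          (ℕ.≤-trans k≤ (ℕ.≤-trans (ℕ.≤-reflexive (sym (ℕ.+-suc fuel ∣ B ∣))) (ℕ.+-monoʳ-≤ fuel grows)))
          (add-forceable B⊆cl v-forceable)
      ... | no stuck with all? (_∈? B)
      ...   | yes everything∈B = yes (λ v → B⊆cl (everything∈B v))
      ...   | no ¬everything∈B = no λ all∈cl →
                let (v , v∉B) = ¬∀⟶∃¬ k _ (_∈? B) ¬everything∈B in v∉B (closure⊆ stuck (all∈cl v))

    closure-total? : Dec (∀ v → InClosure K U v)
    closure-total? = saturate k Subset.⊥ (ℕ.m≤m+n k _) (λ w∈⊥ → contradiction w∈⊥ ∉⊥)

  powerDominating? : ∀ S → Dec (PowerDominating K S)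
  powerDominating? S = closure-total? λ v → (v ∈? S) ⊎-dec any? λ s → (s ∈? S) ×-dec Adj? s v

  complement-adj : ∀ {u v} → ¬ Adj K u v → u ≢ v → Adj (complement K) u v
  complement-adj {u} {v} u≁v u≢v with adj K u v | u ≟ v
  ... | true | _ = contradiction refl u≁v
  ... | false | yes u≡v = contradiction u≡v u≢v
  ... | false | no _ = refl

  complement-adj⁻ : ∀ {u v} → Adj (complement K) u v → ¬ Adj K u v
  complement-adj⁻ {u} {v} u~ᶜv with adj K u v
  complement-adj⁻ () | true
  ... | false = λ ()

  dominatingEdge⇒totallyDominating : ∀ {u v} → Adj K u v → Dominating K (⁅ u ⁆ ∪ ⁅ v ⁆)
                                  → TotallyDominating K (⁅ u ⁆ ∪ ⁅ v ⁆)
  dominatingEdge⇒totallyDominating {u} {v} u~v dom w with dom w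
  ... | inj₂ neighbour = neighbour
  ... | inj₁ w∈ with x∈⁅x⁆∪⁅y⁆⁻ w∈
  ...   | inj₁ refl = v , y∈⁅x⁆∪⁅y⁆ , Adj-sym u~v
  ...   | inj₂ refl = u , x∈⁅x⁆∪⁅y⁆ , u~v

  ¬distLe2ᶜ⇔totallyDominating : ∀ {u v} → (¬ DistLe2 (complement K) u v) ⇔ TotallyDominating K (⁅ u ⁆ ∪ ⁅ v ⁆)
  ¬distLe2ᶜ⇔totallyDominating {u} {v} = mk⇔ to from
    where
    far⇒adj : ¬ DistLe2 (complement K) u v → Adj K u v
    far⇒adj far with Adj? u v
    ... | yes u~v = u~v
    ... | no u≁v = contradiction (inj₂ (inj₁ (complement-adj u≁v (λ u≡v → far (inj₁ u≡v))))) far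

    to : ¬ DistLe2 (complement K) u v → TotallyDominating K (⁅ u ⁆ ∪ ⁅ v ⁆)
    to far w with w ≟ u | w ≟ v
    ... | yes refl | _ = v , y∈⁅x⁆∪⁅y⁆ , Adj-sym (far⇒adj far)
    ... | no _ | yes refl = u , x∈⁅x⁆∪⁅y⁆ , far⇒adj far
    ... | no w≢u | no w≢v with Adj? u w | Adj? v w
    ...   | yes u~w | _ = u , x∈⁅x⁆∪⁅y⁆ , u~w
    ...   | no _ | yes v~w = v , y∈⁅x⁆∪⁅y⁆ , v~w
    ...   | no u≁w | no v≁w = contradiction (inj₂ (inj₂ (w , complement-adj u≁w (λ u≡w → w≢u (sym u≡w)) ,
                                  complement-adj (λ w~v → v≁w (Adj-sym w~v)) w≢v))) far

    from : TotallyDominating K (⁅ u ⁆ ∪ ⁅ v ⁆) → ¬ DistLe2 (complement K) u v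
    from td (inj₁ refl) with td u
    ... | d , d∈ , d~u with x∈⁅x⁆∪⁅y⁆⁻ d∈
    ...   | inj₁ refl = Adj⇒≢ d~u refl
    ...   | inj₂ refl = Adj⇒≢ d~u refl
    from td (inj₂ (inj₁ u~ᶜv)) with td v
    ... | d , d∈ , d~v with x∈⁅x⁆∪⁅y⁆⁻ d∈
    ...   | inj₁ refl = complement-adj⁻ u~ᶜv d~v
    ...   | inj₂ refl = Adj⇒≢ d~v refl
    from td (inj₂ (inj₂ (w , u~ᶜw , w~ᶜv))) with td w
    ... | d , d∈ , d~w with x∈⁅x⁆∪⁅y⁆⁻ d∈
    ...   | inj₁ refl = complement-adj⁻ u~ᶜw d~w
    ...   | inj₂ refl = complement-adj⁻ w~ᶜv (Adj-sym d~w)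

module Minimum {k : ℕ} (P : Subset k → Set)
               (P-mono : ∀ {S T} → S ⊆ T → P S → P T) (P-nonempty : ∀ {S} → P S → Nonempty S) where

  IsMinimum : ℕ → Set
  IsMinimum c = (Σ (Subset k) λ S → P S × ∣ S ∣ ≡ c) × (∀ S → P S → c ≤ ∣ S ∣)

  NoSingleton : Set
  NoSingleton = ∀ x → ¬ P ⁅ x ⁆

  noSingleton⇒2≤∣S∣ : NoSingleton → ∀ {S} → P S → 2 ≤ ∣ S ∣
  noSingleton⇒2≤∣S∣ none {S} PS with P-nonempty PS | ∣ S ∣ ℕ.≤? 1
  ... | x , x∈S | yes ∣S∣≤1 = contradiction (P-mono (∣p∣≤1⇒p⊆⁅x⁆ x∈S ∣S∣≤1) PS) (none x)
  ... | _ | no ∣S∣≰1 = ℕ.≰⇒> ∣S∣≰1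

  isMinimum1⇔ : IsMinimum 1 ⇔ ∃ λ x → P ⁅ x ⁆
  isMinimum1⇔ = mk⇔ to from
    where
    to : IsMinimum 1 → ∃ λ x → P ⁅ x ⁆
    to ((S , PS , ∣S∣≡1) , _) with P-nonempty PS
    ... | x , x∈S = x , P-mono (∣p∣≤1⇒p⊆⁅x⁆ x∈S (ℕ.≤-reflexive ∣S∣≡1)) PS
    from : (∃ λ x → P ⁅ x ⁆) → IsMinimum 1
    from (x , P⁅x⁆) = (⁅ x ⁆ , P⁅x⁆ , ∣⁅x⁆∣≡1 x) , λ _ PS → x∈p⇒0<∣p∣ (proj₂ (P-nonempty PS))

  isMinimum2⇔ : IsMinimum 2 ⇔ (∃₂ (λ x y → x ≢ y × P (⁅ x ⁆ ∪ ⁅ y ⁆)) × NoSingleton)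
  isMinimum2⇔ = mk⇔ to from
    where
    minimal⇒none : (∀ S → P S → 2 ≤ ∣ S ∣) → NoSingleton
    minimal⇒none minimal x P⁅x⁆ =
      contradiction (ℕ.≤-trans (minimal _ P⁅x⁆) (ℕ.≤-reflexive (∣⁅x⁆∣≡1 x))) λ { (s≤s ()) }
    to : IsMinimum 2 → ∃₂ (λ x y → x ≢ y × P (⁅ x ⁆ ∪ ⁅ y ⁆)) × NoSingleton
    to ((S , PS , ∣S∣≡2) , minimal) with P-nonempty PS
    ... | x , x∈S with ∣p∣≤2⇒p⊆⁅x⁆∪⁅y⁆ x∈S (ℕ.≤-reflexive ∣S∣≡2)
    ...   | inj₁ S⊆⁅x⁆ = contradiction (P-mono S⊆⁅x⁆ PS) (minimal⇒none minimal x)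
    ...   | inj₂ (y , x≢y , S⊆⁅x,y⁆) = (x , y , x≢y , P-mono S⊆⁅x,y⁆ PS) , minimal⇒none minimal
    from : ∃₂ (λ x y → x ≢ y × P (⁅ x ⁆ ∪ ⁅ y ⁆)) × NoSingleton → IsMinimum 2
    from ((x , y , x≢y , P⁅x,y⁆) , none) = (_ , P⁅x,y⁆ , ∣⁅x⁆∪⁅y⁆∣≡2 x≢y) , λ _ → noSingleton⇒2≤∣S∣ none

  minimum>1⇔ : (∀ S → P S → 1 < ∣ S ∣) ⇔ NoSingleton
  minimum>1⇔ = mk⇔ (λ minimal x P⁅x⁆ → ℕ.<-irrefl (sym (∣⁅x⁆∣≡1 x)) (minimal _ P⁅x⁆))
                   (λ none _ → noSingleton⇒2≤∣S∣ none)

module LexProduct {m n : ℕ} (G : Graph m) (H : Graph n) where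

  G∘H : Graph (m * n)
  G∘H = lexProd G H

  fst : Fin (m * n) → Fin m
  fst = quotient n

  snd : Fin (m * n) → Fin n
  snd = remainder {m} n

  pair : Fin m → Fin n → Fin (m * n)
  pair = combine

  fst-pair : ∀ g h → fst (pair g h) ≡ g
  fst-pair g h = cong proj₁ (remQuot-combine g h)

  snd-pair : ∀ g h → snd (pair g h) ≡ h
  snd-pair g h = cong proj₂ (remQuot-combine g h)

  pair-fst-snd : ∀ v → pair (fst v) (snd v) ≡ v
  pair-fst-snd = combine-remQuot {m} n

  pair-snd : ∀ {g v} → fst v ≡ g → pair g (snd v) ≡ v
  pair-snd {v = v} refl = pair-fst-snd v

  pair-≢ : ∀ {g g' h h'} → g ≢ g' → pair g h ≢ pair g' h'
  pair-≢ {g} {g'} {h} {h'} g≢g' gh≡g'h' =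
    g≢g' (trans (sym (fst-pair g h)) (trans (cong fst gh≡g'h') (fst-pair g' h')))

  adj-fst : ∀ {i j} → Adj G (fst i) (fst j) → Adj G∘H i j
  adj-fst fi~fj rewrite fi~fj = refl

  adj-snd : ∀ {i j} → fst i ≡ fst j → Adj H (snd i) (snd j) → Adj G∘H i j
  adj-snd {i} {j} fi≡fj si~sj with fst i ≟ fst j
  ... | no fi≢fj = contradiction fi≡fj fi≢fj
  ... | yes _ rewrite si~sj = Bool.∨-zeroʳ (adj G (fst i) (fst j))

  adj-cases : ∀ {i j} → Adj G∘H i j → Adj G (fst i) (fst j) ⊎ (fst i ≡ fst j × Adj H (snd i) (snd j))
  adj-cases {i} {j} i~j with adj G (fst i) (fst j) | fst i ≟ fst j | adj H (snd i) (snd j)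
  ... | true  | _ | _ = inj₁ refl
  ... | false | yes fi≡fj | true = inj₂ (fi≡fj , refl)
  adj-cases () | false | yes _ | false
  adj-cases () | false | no _ | _

  adj-pair-fst : ∀ {i g h} → Adj G (fst i) g → Adj G∘H i (pair g h)
  adj-pair-fst {g = g} {h} fi~g = adj-fst (subst (Adj G _) (sym (fst-pair g h)) fi~g)

  pair-adj-fst : ∀ {g h j} → Adj G g (fst j) → Adj G∘H (pair g h) j
  pair-adj-fst {g} {h} g~fj = adj-fst (subst (λ z → Adj G z _) (sym (fst-pair g h)) g~fj)

  adj-pair-snd : ∀ {i g h} → fst i ≡ g → Adj H (snd i) h → Adj G∘H i (pair g h)
  adj-pair-snd {g = g} {h} fi≡g si~h =
    adj-snd (trans fi≡g (sym (fst-pair g h))) (subst (Adj H _) (sym (snd-pair g h)) si~h)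

  adj-pair-pair : ∀ {g h h'} → Adj H h h' → Adj G∘H (pair g h) (pair g h')
  adj-pair-pair {g} {h} h~h' =
    adj-pair-snd (fst-pair g h) (subst (λ z → Adj H z _) (sym (snd-pair g h)) h~h')

  -- A vertex forced from a neighbouring layer has all the rest of its layer black, so any
  -- H-neighbour of it (there is one) forces it inside H.
  module _ (noIsolated : NoIsolated H) {U : Fin (m * n) → Set} {T : Fin n → Set} (g : Fin m)
           (seed : ∀ {v} → U v → fst v ≡ g → T (snd v)) where

    closure-layer : ∀ {v} → InClosure G∘H U v → fst v ≡ g → InClosure H T (snd v)
    closure-layer (init u) fv≡g = init (seed u fv≡g)
    closure-layer {v} (force {u} u∈ u~v rest) fv≡g = replay (adj-cases u~v)
      where
      black : ∀ h → h ≢ snd v → Adj G∘H u (pair g h) → InClosure H T h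
      black h h≢sv u~gh = subst (InClosure H T) (snd-pair g h)
        (closure-layer (rest (pair g h) u~gh λ gh≡v → h≢sv (trans (sym (snd-pair g h)) (cong snd gh≡v)))
                       (fst-pair g h))

      replay : Adj G (fst u) (fst v) ⊎ (fst u ≡ fst v × Adj H (snd u) (snd v)) → InClosure H T (snd v)
      replay (inj₂ (fu≡fv , su~sv)) =
        force (closure-layer u∈ fu≡g) su~sv λ h su~h h≢sv → black h h≢sv (adj-pair-snd fu≡g su~h)
        where
        fu≡g : fst u ≡ g
        fu≡g = trans fu≡fv fv≡g
      replay (inj₁ fu~fv) with noIsolated (snd v)
      ... | y , y~sv =
        force (black y (Adj⇒≢ {K = H} y~sv) (adj-pair-fst fu~g)) y~sv λ h _ h≢sv → black h h≢sv (adj-pair-fst fu~g)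
        where
        fu~g : Adj G (fst u) g
        fu~g = subst (Adj G (fst u)) fv≡g fu~fv

  module _ {U : Fin (m * n) → Set} {T : Fin n → Set} (g : Fin m)
           (seed : ∀ {h} → T h → InClosure G∘H U (pair g h))
           (neighbourLayers : ∀ {v} → Adj G g (fst v) → InClosure G∘H U v) where

    closure-lift : ∀ {h} → InClosure H T h → InClosure G∘H U (pair g h)
    closure-lift (init t) = seed t
    closure-lift (force {u} {v} u∈ u~v rest) = force (closure-lift u∈) (adj-pair-pair u~v) black
      where
      black : ∀ w → Adj G∘H (pair g u) w → w ≢ pair g v → InClosure G∘H U w
      black w gu~w w≢gv with adj-cases gu~w
      ... | inj₁ fgu~fw = neighbourLayers (subst (λ z → Adj G z (fst w)) (fst-pair g u) fgu~fw)
      ... | inj₂ (fgu≡fw , sgu~sw) = subst (InClosure G∘H U) (pair-snd fw≡g)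
            (closure-lift (rest (snd w) (subst (λ z → Adj H z (snd w)) (snd-pair g u) sgu~sw)
                                        λ sw≡v → w≢gv (trans (sym (pair-snd fw≡g)) (cong (pair g) sw≡v))))
        where
        fw≡g : fst w ≡ g
        fw≡g = trans (sym fgu≡fw) (fst-pair g u)

  module _ {D : Subset m} {S : Subset (m * n)} {h : Fin n} (D×h⊆S : ∀ {g} → g ∈ D → pair g h ∈ S) where

    dominating-∘ : TotallyDominating G D → Dominating G∘H S
    dominating-∘ td v with td (fst v)
    ... | d , d∈D , d~fv = inj₂ (pair d h , D×h⊆S d∈D , pair-adj-fst d~fv)

    powerDominating-∘ : Dominating G D → PowerDominating H ⁅ h ⁆ → PowerDominating G∘H S
    powerDominating-∘ dom pd v with dom (fst v)
    ... | inj₂ (d , d∈D , d~fv) = init (inj₂ (pair d h , D×h⊆S d∈D , pair-adj-fst d~fv))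
    ... | inj₁ fv∈D = subst (InClosure G∘H (InClosedNbhd G∘H S)) (pair-fst-snd v)
                            (closure-lift (fst v) seed neighbourLayer (pd (snd v)))
      where
      gh∈S : pair (fst v) h ∈ S
      gh∈S = D×h⊆S fv∈D
      seed : ∀ {h'} → InClosedNbhd H ⁅ h ⁆ h' → InClosure G∘H (InClosedNbhd G∘H S) (pair (fst v) h')
      seed (inj₁ h'∈⁅h⁆) rewrite x∈⁅y⁆⇒x≡y h h'∈⁅h⁆ = init (inj₁ gh∈S)
      seed (inj₂ (h″ , h″∈⁅h⁆ , h″~h')) rewrite x∈⁅y⁆⇒x≡y h h″∈⁅h⁆ = init (inj₂ (_ , gh∈S , adj-pair-pair h″~h'))
      neighbourLayer : ∀ {w} → Adj G (fst v) (fst w) → InClosure G∘H (InClosedNbhd G∘H S) w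
      neighbourLayer fv~fw = init (inj₂ (_ , gh∈S , pair-adj-fst fv~fw))

  powerDominating-⁅pair⁆ : ∀ {g h} → Dominating G ⁅ g ⁆ → PowerDominating H ⁅ h ⁆ → PowerDominating G∘H ⁅ pair g h ⁆
  powerDominating-⁅pair⁆ {h = h} = powerDominating-∘ (x∈⁅y⁆⇒fx∈⁅fy⁆ (λ g → pair g h))

  module Projection (noIsolated : NoIsolated H) (h₀ : Fin n) where

    powerDominating⇒dominating-fst : ∀ {S : Subset (m * n)} {D : Subset m} → PowerDominating G∘H S
                                   → (∀ {x} → x ∈ S → fst x ∈ D) → Dominating G D
    powerDominating⇒dominating-fst {S} {D} pd fS⊆D g with g ∈? D
    ... | yes g∈D = inj₁ g∈D
    ... | no g∉D with any? (λ d → (d ∈? D) ×-dec Adj? {K = G} d g)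
    ...   | yes (d , d∈D , d~g) = inj₂ (d , d∈D , d~g)
    ...   | no no-neighbour =
      ⊥-elim (proj₂ (closure⇒seed (closure-layer noIsolated g nothingInLayer (pd (pair g h₀)) (fst-pair g h₀))))
      where
      nothingInLayer : ∀ {v} → InClosedNbhd G∘H S v → fst v ≡ g → ⊥
      nothingInLayer (inj₁ v∈S) refl = g∉D (fS⊆D v∈S)
      nothingInLayer (inj₂ (s , s∈S , s~v)) refl with adj-cases s~v
      ... | inj₁ fs~fv = no-neighbour (fst s , fS⊆D s∈S , fs~fv)
      ... | inj₂ (fs≡fv , _) = g∉D (subst (_∈ D) fs≡fv (fS⊆D s∈S))

    powerDominating⇒powerDominating-snd : ∀ {S : Subset (m * n)} {s} → PowerDominating G∘H S
      → (∀ {x} → x ∈ S → x ≡ s ⊎ (fst x ≢ fst s × ¬ Adj G (fst x) (fst s)))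
      → PowerDominating H ⁅ snd s ⁆
    powerDominating⇒powerDominating-snd {S} {s} pd S-apart h =
      subst (InClosure H _) (snd-pair (fst s) h)
            (closure-layer noIsolated (fst s) seed (pd (pair (fst s) h)) (fst-pair (fst s) h))
      where
      seed : ∀ {v} → InClosedNbhd G∘H S v → fst v ≡ fst s → InClosedNbhd H ⁅ snd s ⁆ (snd v)
      seed (inj₁ v∈S) fv≡fs with S-apart v∈S
      ... | inj₁ refl = inj₁ (x∈⁅x⁆ (snd s))
      ... | inj₂ (fv≢fs , _) = contradiction fv≡fs fv≢fs
      seed (inj₂ (x , x∈S , x~v)) fv≡fs with S-apart x∈S | adj-cases x~v
      ... | inj₁ refl | inj₁ fs~fv = contradiction (sym fv≡fs) (Adj⇒≢ {K = G} fs~fv)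
      ... | inj₁ refl | inj₂ (_ , ss~sv) = inj₂ (snd s , x∈⁅x⁆ (snd s) , ss~sv)
      ... | inj₂ (_ , fx≁fs) | inj₁ fx~fv = contradiction (subst (Adj G (fst x)) fv≡fs fx~fv) fx≁fs
      ... | inj₂ (fx≢fs , _) | inj₂ (fx≡fv , _) = contradiction (trans fx≡fv fv≡fs) fx≢fs

    powerDominating-⁅⁆⇒ : ∀ {x} → PowerDominating G∘H ⁅ x ⁆ → Dominating G ⁅ fst x ⁆ × PowerDominating H ⁅ snd x ⁆
    powerDominating-⁅⁆⇒ {x} pd = powerDominating⇒dominating-fst pd (x∈⁅y⁆⇒fx∈⁅fy⁆ fst)
                               , powerDominating⇒powerDominating-snd pd (λ x'∈⁅x⁆ → inj₁ (x∈⁅y⁆⇒x≡y x x'∈⁅x⁆))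

    ∃-powerDominating-⁅⁆⇔ : (∃ λ x → PowerDominating G∘H ⁅ x ⁆)
                          ⇔ ((∃ λ g → Dominating G ⁅ g ⁆) × (∃ λ h → PowerDominating H ⁅ h ⁆))
    ∃-powerDominating-⁅⁆⇔ = mk⇔
      (λ (x , pd) → let (dom , pdH) = powerDominating-⁅⁆⇒ pd in (fst x , dom) , (snd x , pdH))
      (λ ((g , dom) , (h , pd)) → pair g h , powerDominating-⁅pair⁆ dom pd)

    PairPowerDominates : Set
    PairPowerDominates = (∃₂ λ x y → x ≢ y × PowerDominating G∘H (⁅ x ⁆ ∪ ⁅ y ⁆)) × (∀ x → ¬ PowerDominating G∘H ⁅ x ⁆)

    PairPowerDominatesCases : Set
    PairPowerDominatesCases =
        ((∃₂ λ g g' → g ≢ g' × Dominating G (⁅ g ⁆ ∪ ⁅ g' ⁆)) × (∀ g → ¬ Dominating G ⁅ g ⁆))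
          × (∃ λ h → PowerDominating H ⁅ h ⁆)
      ⊎ DiamGt2 (complement G) × (∀ h → ¬ PowerDominating H ⁅ h ⁆)

    pairPowerDominates⇒cases : Nontrivial G → PairPowerDominates → PairPowerDominatesCases
    pairPowerDominates⇒cases nontrivialG ((x , y , _ , pd) , none) = byLayers (fst x ≟ fst y)
      where
      dom : Dominating G (⁅ fst x ⁆ ∪ ⁅ fst y ⁆)
      dom = powerDominating⇒dominating-fst pd (x∈⁅y⁆∪⁅z⁆⇒fx∈⁅fy⁆∪⁅fz⁆ fst)

      notBoth : ∀ {g h} → Dominating G ⁅ g ⁆ → ¬ PowerDominating H ⁅ h ⁆
      notBoth domG pdH = none _ (powerDominating-⁅pair⁆ domG pdH)

      separate : ∀ {h} → fst x ≢ fst y → PowerDominating H ⁅ h ⁆ → PairPowerDominatesCases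
      separate fx≢fy pdH = inj₁ (((fst x , fst y , fx≢fy , dom) , λ _ domG → notBoth domG pdH) , _ , pdH)

      distant : ∀ {u v} → Adj G u v → Dominating G (⁅ u ⁆ ∪ ⁅ v ⁆) → (∀ h → ¬ PowerDominating H ⁅ h ⁆)
              → PairPowerDominatesCases
      distant u~v domUV noPdH =
        inj₂ ((_ , _ , Equivalence.from (¬distLe2ᶜ⇔totallyDominating {K = G})
                                        (dominatingEdge⇒totallyDominating {K = G} u~v domUV)) , noPdH)

      byAdjacency : fst x ≢ fst y → Dec (Adj G (fst x) (fst y)) → PairPowerDominatesCases
      byAdjacency fx≢fy (no fx≁fy) = separate fx≢fy (powerDominating⇒powerDominating-snd pd apart)
        where
        apart : ∀ {z} → z ∈ ⁅ x ⁆ ∪ ⁅ y ⁆ → z ≡ x ⊎ (fst z ≢ fst x × ¬ Adj G (fst z) (fst x))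
        apart z∈ with x∈⁅x⁆∪⁅y⁆⁻ z∈
        ... | inj₁ z≡x = inj₁ z≡x
        ... | inj₂ refl = inj₂ ((λ fy≡fx → fx≢fy (sym fy≡fx)) , λ fy~fx → fx≁fy (Adj-sym {K = G} fy~fx))
      byAdjacency fx≢fy (yes fx~fy) with any? (λ h → powerDominating? {K = H} ⁅ h ⁆)
      ... | yes (h , pdH) = separate fx≢fy pdH
      ... | no noPdH = distant fx~fy dom (λ h pdH → noPdH (h , pdH))

      byLayers : Dec (fst x ≡ fst y) → PairPowerDominatesCases
      byLayers (no fx≢fy) = byAdjacency fx≢fy (Adj? {K = G} (fst x) (fst y))
      byLayers (yes fx≡fy) with another nontrivialG (fst x)
      ... | v , v≢fx =
        distant (dominating-⁅u⁆⇒adj {K = G} domX v≢fx) (dominating-mono {K = G} (p⊆p∪q ⁅ v ⁆) domX) (λ _ → notBoth domX)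
        where
        domX : Dominating G ⁅ fst x ⁆
        domX = dominating-mono {K = G} (⁅x⁆∪⁅y⁆⊆⁅x⁆ fx≡fy) dom

    cases⇒pairPowerDominates : PairPowerDominatesCases → PairPowerDominates
    cases⇒pairPowerDominates (inj₁ (((g , g' , g≢g' , dom) , noDomG) , h , pdH)) =
      (pair g h , pair g' h , pair-≢ g≢g' , powerDominating-∘ (x∈⁅y⁆∪⁅z⁆⇒fx∈⁅fy⁆∪⁅fz⁆ (λ g → pair g h)) dom pdH)
      , λ x pd → noDomG (fst x) (proj₁ (powerDominating-⁅⁆⇒ pd))
    cases⇒pairPowerDominates (inj₂ ((u , v , far) , noPdH)) =
      (pair u h₀ , pair v h₀ , pair-≢ (λ u≡v → far (inj₁ u≡v))
      , dominating⇒powerDominating (dominating-∘ (x∈⁅y⁆∪⁅z⁆⇒fx∈⁅fy⁆∪⁅fz⁆ (λ g → pair g h₀))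
                                     (Equivalence.to (¬distLe2ᶜ⇔totallyDominating {K = G}) far)))
      , λ x pd → noPdH (snd x) (proj₂ (powerDominating-⁅⁆⇒ pd))

mainTheorem9 : ∀ {m n : ℕ} (G : Graph m) (H : Graph n)
    → Nontrivial G → Connected G → Nontrivial H → Connected H
    → (IsPowDomNum (lexProd G H) 1 ⇔ (IsDomNum G 1 × IsPowDomNum H 1))
    × (IsPowDomNum (lexProd G H) 2 ⇔
        ((IsDomNum G 2 × IsPowDomNum H 1) ⊎ (DiamGt2 (complement G) × PowDomNumGt H 1)))
mainTheorem9 {m} {n} G H nontrivialG _ nontrivialH connectedH =
  ⇔.trans γP∘.isMinimum1⇔ (⇔.trans ∃-powerDominating-⁅⁆⇔ (⇔.sym (γG.isMinimum1⇔ ×-⇔ γPH.isMinimum1⇔))) ,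
  ⇔.trans γP∘.isMinimum2⇔ (⇔.trans (mk⇔ (pairPowerDominates⇒cases nontrivialG) cases⇒pairPowerDominates)
    (⇔.sym ((γG.isMinimum2⇔ ×-⇔ γPH.isMinimum1⇔) ⊎-⇔ (⇔.refl ×-⇔ γPH.minimum>1⇔))))
  where
  g₀ : Fin m
  g₀ = fromℕ< nontrivialG
  h₀ : Fin n
  h₀ = fromℕ< nontrivialH
  open LexProduct G H
  open LexProduct.Projection G H (connected⇒noIsolated nontrivialH connectedH) h₀
  module γG = Minimum (Dominating G) (dominating-mono {K = G}) (dominating⇒Nonempty {K = G} g₀)
  module γPH = Minimum (PowerDominating H) (powerDominating-mono {K = H}) (powerDominating⇒Nonempty h₀)
  module γP∘ = Minimum (PowerDominating G∘H) (powerDominating-mono {K = G∘H}) (powerDominating⇒Nonempty (pair g₀ h₀))
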